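{- Let $E$ be a finite nonempty set and $u:2^E\to\mathbb{R}$, and define its dual $u^\bullet:2^E\to\mathbb{R}$ by $u^\bullet(X)=u(E\setminus X)$. Then $u$ is ordinally w-concave if and only if $u^\bullet$ is ordinally w-concave.
   Context: Notation: for $X\subseteq E$ and $x\in E\setminus X$, $X+x=X\cup\{x\}$; for $x\in X$, $X-x=X\setminus\{x\}$. The symbol $\emptyset$ is also used as a formal element not in $E$, with $X+\emptyset=X-\emptyset=X$. A function $u:2^E\to\mathbb{R}$ is ordinally w-concave if for every $X,X'\in 2^E$ with $X\neq X'$ there exist distinct $x\in(X\setminus X')\cup\{\emptyset\}$ and $x'\in(X'\setminus X)\cup\{\emptyset\}$ such that (i) $u(X)<u(X-x+x')$, or (ii) $u(X')<u(X'-x'+x)$, or (iii) $u(X)=u(X-x+x')$ and $u(X')=u(X'-x'+x)$. -}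

module Defs where

open import Level using (Level)
open import Data.Nat using (ℕ)
open import Data.Fin using (Fin)
open import Data.Fin.Subset using (Subset; _∈_; _∉_; ∁; inside; outside)
open import Data.Vec using (_[_]≔_)
open import Data.Maybe using (Maybe; just; nothing)
open import Data.Product using (∃₂; _×_)
open import Data.Sum using (_⊎_)
open import Data.Unit using (⊤)
open import Relation.Binary.PropositionalEquality using (_≢_)
open import Relation.Binary.Bundles using (StrictTotalOrder)

-- Elements of E ∪ {∅}: `nothing` plays the role of the formal element ∅.
-- X - x   (with X - ∅ = X)
_−_ : ∀ {n} → Subset n → Maybe (Fin n) → Subset n
X − nothing = X
X − just i  = X [ i ]≔ outside

_⊹_ : ∀ {n} → Subset n → Maybe (Fin n) → Subset n
X ⊹ nothing = X
X ⊹ just i  = X [ i ]≔ inside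

infixl 6 _−_ _⊹_

InDiff∅ : ∀ {n} → Maybe (Fin n) → Subset n → Subset n → Set
InDiff∅ nothing  X X' = ⊤
InDiff∅ (just i) X X' = i ∈ X × i ∉ X'

-- Ordinal w-concavity of u : 2^E → R, where R is a strictly totally ordered
-- value set (ℝ being the case of the paper).
module _ {a ℓ₁ ℓ₂ : Level} (R : StrictTotalOrder a ℓ₁ ℓ₂) where
  open StrictTotalOrder R renaming (Carrier to Val)

  OrdinallyWConcave : ∀ {n} → (Subset n → Val) → Set _
  OrdinallyWConcave {n} u =
    ∀ (X X' : Subset n) → X ≢ X' →
      ∃₂ λ (x x' : Maybe (Fin n)) →
        InDiff∅ x X X' × InDiff∅ x' X' X × x ≢ x' ×
        ( u X < u (X − x ⊹ x')
        ⊎ u X' < u (X' − x' ⊹ x)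
        ⊎ (u X ≈ u (X − x ⊹ x') × u X' ≈ u (X' − x' ⊹ x)))

dual : ∀ {a} {A : Set a} {n} → (Subset n → A) → Subset n → A
dual u X = u (∁ X)

{-# OPTIONS --safe #-}
module Submission where

-- Complementation X ↦ E ∖ X is an involution of 2^E that turns the exchange
-- X - x' + x into (E ∖ X) - x + x' and swaps the roles of X ∖ X' and X' ∖ X.
-- Hence a witness pair (x, x') for E ∖ X, E ∖ X' under u becomes, swapped to
-- (x', x), a witness pair for X, X' under u•; as u•• = u this suffices.

open import Defs
open import Data.Nat using (ℕ; suc)
open import Data.Fin using (Fin)
open import Data.Fin.Subset using (Subset; ∁; inside; outside)
open import Data.Fin.Subset.Properties using (x∈∁p⇒x∉p; x∉∁p⇒x∈p)
open import Data.Vec using (_[_]≔_)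
open import Data.Vec.Properties using (map-∘; map-cong; map-id; map-[]≔; []≔-commutes)
open import Data.Bool using (not)
open import Data.Bool.Properties using (not-involutive)
open import Data.Maybe using (Maybe; just; nothing)
open import Data.Product using (_,_)
import Data.Product as Product
import Data.Sum as Sum
open import Data.Unit using (tt)
open import Function using (_∘_)
open import Function.Bundles using (_⇔_; mk⇔)
open import Relation.Binary.Bundles using (StrictTotalOrder)
open import Relation.Binary.PropositionalEquality

∁-involutive : ∀ {n} (X : Subset n) → ∁ (∁ X) ≡ X
∁-involutive X = trans (sym (map-∘ not not X)) (trans (map-cong not-involutive X) (map-id X))

∁-injective : ∀ {n} {X Y : Subset n} → ∁ X ≡ ∁ Y → X ≡ Y
∁-injective {X = X} {Y} ∁X≡∁Y =
  trans (sym (∁-involutive X)) (trans (cong ∁ ∁X≡∁Y) (∁-involutive Y))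

∁-exchange : ∀ {n} (X : Subset n) {x x' : Maybe (Fin n)} → x ≢ x' →
             ∁ (X − x' ⊹ x) ≡ ∁ X − x ⊹ x'
∁-exchange X {nothing} {nothing} _   = refl
∁-exchange X {just i}  {nothing} _   = map-[]≔ not X i
∁-exchange X {nothing} {just j}  _   = map-[]≔ not X j
∁-exchange X {just i}  {just j}  i≢j = begin
  ∁ (X [ j ]≔ outside [ i ]≔ inside)     ≡⟨ map-[]≔ not (X [ j ]≔ outside) i ⟩
  ∁ (X [ j ]≔ outside) [ i ]≔ outside    ≡⟨ cong (_[ i ]≔ outside) (map-[]≔ not X j) ⟩
  ∁ X [ j ]≔ inside [ i ]≔ outside       ≡⟨ []≔-commutes (∁ X) j i (i≢j ∘ cong just ∘ sym) ⟩
  ∁ X [ i ]≔ outside [ j ]≔ inside       ∎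
  where open ≡-Reasoning

InDiff∅-∁ : ∀ {n} {x : Maybe (Fin n)} {X X' : Subset n} →
            InDiff∅ x (∁ X) (∁ X') → InDiff∅ x X' X
InDiff∅-∁ {x = nothing} _                   = tt
InDiff∅-∁ {x = just i}  (i∈∁X , i∉∁X') = x∉∁p⇒x∈p i∉∁X' , x∈∁p⇒x∉p i∈∁X

dual-involutive : ∀ {a} {A : Set a} {n} (u : Subset n → A) → u ≗ dual (dual u)
dual-involutive u = cong u ∘ sym ∘ ∁-involutive

module _ {a ℓ₁ ℓ₂} (R : StrictTotalOrder a ℓ₁ ℓ₂) where
  open StrictTotalOrder R using (_<_; _≈_) renaming (Carrier to Val)

  ordinallyWConcave-dual : ∀ {n} {u v : Subset n → Val} → v ≗ dual u →
                           OrdinallyWConcave R u → OrdinallyWConcave R v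
  ordinallyWConcave-dual {u = u} {v} v≗u• wc X X' X≢X'
    with wc (∁ X) (∁ X') (X≢X' ∘ ∁-injective)
  ... | x , x' , x∈ , x'∈ , x≢x' , verdict =
    x' , x , InDiff∅-∁ x'∈ , InDiff∅-∁ x∈ , x≢x' ∘ sym ,
    Sum.map (subst₂ _<_ (at X) (exchanged X x≢x'))
      (Sum.map (subst₂ _<_ (at X') (exchanged X' (x≢x' ∘ sym)))
        (Product.map (subst₂ _≈_ (at X) (exchanged X x≢x'))
                     (subst₂ _≈_ (at X') (exchanged X' (x≢x' ∘ sym)))))
      verdict
    where
      at : ∀ Y → u (∁ Y) ≡ v Y
      at Y = sym (v≗u• Y)

      exchanged : ∀ Y {y y'} → y ≢ y' → u (∁ Y − y ⊹ y') ≡ v (Y − y' ⊹ y)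
      exchanged Y y≢y' = trans (cong u (sym (∁-exchange Y y≢y'))) (at _)

lemma4p3 : ∀ {a ℓ₁ ℓ₂} (R : StrictTotalOrder a ℓ₁ ℓ₂) (m : ℕ)
             (u : Subset (suc m) → StrictTotalOrder.Carrier R) →
             OrdinallyWConcave R u ⇔ OrdinallyWConcave R (dual u)
lemma4p3 R m u = mk⇔ (ordinallyWConcave-dual R (λ _ → refl))
                     (ordinallyWConcave-dual R (dual-involutive u))
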